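{- Let $r\ge 3$ and let $\{P,Q\}$ be a mismatched pair of $r$-patterns. Then there exists $1\le j\le r$ such that $\{P^{ -j},Q^{ -j}\}$ is a mismatched pair of $(r-1)$-patterns.
   Context: An $r$-pattern is an ordered $r$-matching of size $2$ (two disjoint $r$-sets on a linearly ordered set of $2r$ vertices) up to order-isomorphism, written as a word in letters $A,B$ each occurring $r$ times. For an $r$-pattern $P$ and $1\le j\le r$, $P^{ -j}$ is the $(r-1)$-pattern obtained by deleting the $j$-th occurrence of $A$ and the $j$-th occurrence of $B$ from the word $P$. An $r$-pattern $P$ is collectable if its word splits into consecutive blocks $P=S_1\cdots S_s$ with each $S_i$ of the form $A^tB^t$ or $B^tA^t$ ($t\ge1$); the splitting is unique and the composition of $P$ is $\lambda_P=(|S_1|/2,\dots,|S_s|/2)$. Two collectable patterns $P,Q$ are harmonious if $\lambda_P=\lambda_Q$. A pair $\{P,Q\}$ is a mismatch if one of $P,Q$ is collectable and the other is not, or both are collectable but not harmonious. -}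

module Defs where

open import Data.Nat using (ℕ; zero; suc; _+_)
open import Data.List using (List; []; _∷_; _++_)
open import Data.Product using (Σ; ∃; _×_; _,_)
open import Data.Sum using (_⊎_)
open import Relation.Nullary using (¬_)
open import Relation.Binary.PropositionalEquality using (_≡_)

data Letter : Set where
  A B : Letter

count : Letter → List Letter → ℕ
count x [] = 0
count A (A ∷ w) = suc (count A w)
count A (B ∷ w) = count A w
count B (A ∷ w) = count B w
count B (B ∷ w) = suc (count B w)

IsPattern : ℕ → List Letter → Set
IsPattern r w = count A w ≡ r × count B w ≡ r

rep : ℕ → Letter → List Letter
rep zero x = []
rep (suc t) x = x ∷ rep t x

-- delete the j-th occurrence (1-indexed) of letter x; j = 0 or too few
-- occurrences leaves the word unchanged
delOcc : Letter → ℕ → List Letter → List Letter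
delOcc x zero w = w
delOcc x (suc j) [] = []
delOcc A (suc zero) (A ∷ w) = w
delOcc A (suc (suc j)) (A ∷ w) = A ∷ delOcc A (suc j) w
delOcc A (suc j) (B ∷ w) = B ∷ delOcc A (suc j) w
delOcc B (suc zero) (B ∷ w) = w
delOcc B (suc (suc j)) (B ∷ w) = B ∷ delOcc B (suc j) w
delOcc B (suc j) (A ∷ w) = A ∷ delOcc B (suc j) w

minus : List Letter → ℕ → List Letter
minus P j = delOcc B j (delOcc A j P)

-- CollectableWith P λ : P splits into consecutive blocks A^t B^t or B^t A^t
-- (t ≥ 1), with composition λ = (t_1, ..., t_s).
data CollectableWith : List Letter → List ℕ → Set where
  done  : CollectableWith [] []
  blkAB : ∀ t {w ts} → CollectableWith w ts →
          CollectableWith (rep (suc t) A ++ rep (suc t) B ++ w) (suc t ∷ ts)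
  blkBA : ∀ t {w ts} → CollectableWith w ts →
          CollectableWith (rep (suc t) B ++ rep (suc t) A ++ w) (suc t ∷ ts)

Collectable : List Letter → Set
Collectable P = ∃ λ ls → CollectableWith P ls

Harmonious : List Letter → List Letter → Set
Harmonious P Q = ∃ λ ls → CollectableWith P ls × CollectableWith Q ls

Mismatch : List Letter → List Letter → Set
Mismatch P Q =
  (Collectable P × ¬ Collectable Q)
  ⊎ (¬ Collectable P × Collectable Q)
  ⊎ (Collectable P × Collectable Q × ¬ Harmonious P Q)

{-# OPTIONS --safe #-}
-- The proof works with the profile of a word, the word recording, letter by
-- letter, whether |#A − #B| rises (A) or falls (B). A word is collectable with
-- composition λ exactly when its profile is A^λ₁ B^λ₁ A^λ₂ B^λ₂ ⋯, so mismatched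
-- words have different profiles. Erasing the j-th A and the j-th B commutes with
-- taking profiles and maps such block words to block words, so P^{-j} stays
-- collectable when P is. Finally, two different words stay different after
-- erasing their j-th A and j-th B for some j ≤ 3: at the first position where
-- they differ, some j ∈ {1, 2, 3} is neither the index of the next A nor that of
-- the next B, so that position survives the erasure.
module Submission where

open import Defs
open import Data.Nat using (ℕ; zero; suc; _+_; _∸_; pred; _≤_; z≤n; s≤s)
open import Data.Nat.Properties
  using ( +-suc; +-identityʳ; ≤-refl; ≤-reflexive; ≤-trans; m≤n⇒m≤1+n; <-≤-connex
        ; m≤n⇒∃[o]m+o≡n; pred[m∸n]≡m∸[1+n])
open import Data.List using (List; []; _∷_; _++_; head)
open import Data.List.Properties using (∷-injectiveʳ; ≡-dec)
open import Data.Product using (∃; ∃₂; _×_; _,_)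
open import Data.Sum using (_⊎_; inj₁; inj₂) renaming (map to map-⊎)
open import Function using (case_of_; _∘_)
open import Relation.Nullary using (Dec; yes; no; contradiction)
open import Relation.Nullary.Decidable using (map′)
open import Relation.Binary.PropositionalEquality

-- erase a b w deletes the a-th A and the b-th B of w; index 0 deletes nothing.
consUnless1 : ℕ → Letter → List Letter → List Letter
consUnless1 (suc zero) x w = w
consUnless1 zero x w = x ∷ w
consUnless1 (suc (suc i)) x w = x ∷ w

erase : ℕ → ℕ → List Letter → List Letter
erase a b [] = []
erase a b (A ∷ w) = consUnless1 a A (erase (pred a) b w)
erase a b (B ∷ w) = consUnless1 b B (erase a (pred b) w)

erase-0-0 : ∀ w → erase 0 0 w ≡ w
erase-0-0 [] = refl
erase-0-0 (A ∷ w) = cong (A ∷_) (erase-0-0 w)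
erase-0-0 (B ∷ w) = cong (B ∷_) (erase-0-0 w)

erase-0-0-commute : ∀ (f : List Letter → List Letter) w → f (erase 0 0 w) ≡ erase 0 0 (f w)
erase-0-0-commute f w = trans (cong f (erase-0-0 w)) (sym (erase-0-0 (f w)))

delOcc-A∷ : ∀ b w → delOcc B b (A ∷ w) ≡ A ∷ delOcc B b w
delOcc-A∷ zero w = refl
delOcc-A∷ (suc zero) w = refl
delOcc-A∷ (suc (suc b)) w = refl

delOcc-B∷ : ∀ a w → delOcc A a (B ∷ w) ≡ B ∷ delOcc A a w
delOcc-B∷ zero w = refl
delOcc-B∷ (suc zero) w = refl
delOcc-B∷ (suc (suc a)) w = refl

delOcc-delOcc≡erase : ∀ a b w → delOcc B b (delOcc A a w) ≡ erase a b w
delOcc-delOcc≡erase zero zero [] = refl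
delOcc-delOcc≡erase zero (suc b) [] = refl
delOcc-delOcc≡erase (suc a) zero [] = refl
delOcc-delOcc≡erase (suc a) (suc b) [] = refl
delOcc-delOcc≡erase zero b (A ∷ w) =
  trans (delOcc-A∷ b w) (cong (A ∷_) (delOcc-delOcc≡erase zero b w))
delOcc-delOcc≡erase (suc zero) b (A ∷ w) = delOcc-delOcc≡erase zero b w
delOcc-delOcc≡erase (suc (suc a)) b (A ∷ w) =
  trans (delOcc-A∷ b _) (cong (A ∷_) (delOcc-delOcc≡erase (suc a) b w))
delOcc-delOcc≡erase a zero (B ∷ w) rewrite delOcc-B∷ a w =
  cong (B ∷_) (delOcc-delOcc≡erase a zero w)
delOcc-delOcc≡erase a (suc zero) (B ∷ w) rewrite delOcc-B∷ a w = delOcc-delOcc≡erase a zero w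
delOcc-delOcc≡erase a (suc (suc b)) (B ∷ w) rewrite delOcc-B∷ a w =
  cong (B ∷_) (delOcc-delOcc≡erase a (suc b) w)

other : Letter → Letter
other A = B
other B = A

-- profile d x w starts at height d = |#A − #B| with x the letter in excess (if
-- d > 0) and writes A for each letter of w raising the height, B for each lowering it.
profile : ℕ → Letter → List Letter → List Letter
profile d x [] = []
profile zero x (y ∷ w) = A ∷ profile 1 y w
profile (suc d) A (A ∷ w) = A ∷ profile (suc (suc d)) A w
profile (suc d) A (B ∷ w) = B ∷ profile d A w
profile (suc d) B (B ∷ w) = A ∷ profile (suc (suc d)) B w
profile (suc d) B (A ∷ w) = B ∷ profile d B w

profile₀ : List Letter → List Letter
profile₀ = profile 0 A

profile-0 : ∀ x w → profile 0 x w ≡ profile₀ w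
profile-0 x [] = refl
profile-0 x (y ∷ w) = refl

profile-rise : ∀ x d w → profile d x (x ∷ w) ≡ A ∷ profile (suc d) x w
profile-rise A zero w = refl
profile-rise A (suc d) w = refl
profile-rise B zero w = refl
profile-rise B (suc d) w = refl

profile-eraseB : ∀ {c} b w → b ≤ c →
  profile c A (erase 0 (suc b) w) ≡ erase 0 (suc b) (profile (suc c) A w)
profile-eraseB b [] _ = refl
profile-eraseB {c} b (A ∷ w) b≤c rewrite profile-rise A c (erase 0 (suc b) w) =
  cong (A ∷_) (profile-eraseB b w (m≤n⇒m≤1+n b≤c))
profile-eraseB {c} zero (B ∷ w) _ = erase-0-0-commute (profile c A) w
profile-eraseB (suc b) (B ∷ w) (s≤s b≤c) = cong (B ∷_) (profile-eraseB b w b≤c)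

profile-eraseA : ∀ {c} a w → a ≤ c →
  profile c B (erase (suc a) 0 w) ≡ erase 0 (suc a) (profile (suc c) B w)
profile-eraseA a [] _ = refl
profile-eraseA {c} a (B ∷ w) a≤c rewrite profile-rise B c (erase (suc a) 0 w) =
  cong (A ∷_) (profile-eraseA a w (m≤n⇒m≤1+n a≤c))
profile-eraseA {c} zero (A ∷ w) _ = erase-0-0-commute (profile c B) w
profile-eraseA (suc a) (A ∷ w) (s≤s a≤c) = cong (B ∷_) (profile-eraseA a w a≤c)

-- A profile has max (#A, #B) rises and min (#A, #B) falls, so the j-th A and the
-- j-th B of w sit at the j-th rise and the j-th fall of its profile; in between
-- the excess is positive and erasure lowers it by one. When A leads by d, the
-- (a+1)-th A and the (d+a+1)-th B still to come form such a pair.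
mutual
  profile-erase-pairA : ∀ d a {b} w → d + a ≡ b →
    profile d A (erase (suc a) (suc b) w) ≡ erase (suc a) (suc b) (profile d A w)
  profile-erase-pairA d a [] _ = refl
  profile-erase-pairA d zero (A ∷ w) d+0≡b rewrite profile-rise A d w =
    profile-eraseB _ w (≤-reflexive (trans (sym d+0≡b) (+-identityʳ d)))
  profile-erase-pairA d (suc a) {b} (A ∷ w) d+1+a≡b
    rewrite profile-rise A d w | profile-rise A d (erase (suc a) (suc b) w) =
    cong (A ∷_) (profile-erase-pairA (suc d) a w (trans (sym (+-suc d a)) d+1+a≡b))
  profile-erase-pairA zero zero (B ∷ w) refl = trans (sym (profile-0 B _)) (profile-eraseA 0 w z≤n)
  profile-erase-pairA zero (suc a) (B ∷ w) refl = cong (A ∷_) (profile-erase-pairB 1 a w refl)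
  profile-erase-pairA (suc d) a (B ∷ w) refl = cong (B ∷_) (profile-erase-pairA d a w refl)

  profile-erase-pairB : ∀ d b {a} w → d + b ≡ a →
    profile d B (erase (suc a) (suc b) w) ≡ erase (suc b) (suc a) (profile d B w)
  profile-erase-pairB d b [] _ = refl
  profile-erase-pairB d zero (B ∷ w) d+0≡a rewrite profile-rise B d w =
    profile-eraseA _ w (≤-reflexive (trans (sym d+0≡a) (+-identityʳ d)))
  profile-erase-pairB d (suc b) {a} (B ∷ w) d+1+b≡a
    rewrite profile-rise B d w | profile-rise B d (erase (suc a) (suc b) w) =
    cong (A ∷_) (profile-erase-pairB (suc d) b w (trans (sym (+-suc d b)) d+1+b≡a))
  profile-erase-pairB zero zero (A ∷ w) refl = trans (profile-0 B _) (profile-eraseB 0 w z≤n)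
  profile-erase-pairB zero (suc b) (A ∷ w) refl = cong (A ∷_) (profile-erase-pairA 1 b w refl)
  profile-erase-pairB (suc d) b (A ∷ w) refl = cong (B ∷_) (profile-erase-pairB d b w refl)

profile-erase : ∀ j w → profile₀ (erase j j w) ≡ erase j j (profile₀ w)
profile-erase zero w = erase-0-0-commute profile₀ w
profile-erase (suc j) w = profile-erase-pairA 0 j w refl

blocks : List ℕ → List Letter
blocks [] = []
blocks (t ∷ μ) = rep t A ++ rep t B ++ blocks μ

profile-climb : ∀ x n d w → profile d x (rep n x ++ w) ≡ rep n A ++ profile (n + d) x w
profile-climb x zero d w = refl
profile-climb x (suc n) d w = begin
  profile d x (x ∷ rep n x ++ w)
    ≡⟨ profile-rise x d _ ⟩
  A ∷ profile (suc d) x (rep n x ++ w)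
    ≡⟨ cong (A ∷_) (profile-climb x n (suc d) w) ⟩
  A ∷ rep n A ++ profile (n + suc d) x w
    ≡⟨ cong (λ k → A ∷ rep n A ++ profile k x w) (+-suc n d) ⟩
  A ∷ rep n A ++ profile (suc n + d) x w
    ∎
  where open ≡-Reasoning

profile-descend : ∀ x n d w → profile (n + d) x (rep n (other x) ++ w) ≡ rep n B ++ profile d x w
profile-descend x zero d w = refl
profile-descend A (suc n) d w = cong (B ∷_) (profile-descend A n d w)
profile-descend B (suc n) d w = cong (B ∷_) (profile-descend B n d w)

profile-block : ∀ x t w →
  profile₀ (rep t x ++ rep t (other x) ++ w) ≡ rep t A ++ rep t B ++ profile₀ w
profile-block x t w = begin
  profile₀ (rep t x ++ rep t (other x) ++ w)
    ≡⟨ profile-0 x _ ⟨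
  profile 0 x (rep t x ++ rep t (other x) ++ w)
    ≡⟨ profile-climb x t 0 _ ⟩
  rep t A ++ profile (t + 0) x (rep t (other x) ++ w)
    ≡⟨ cong (rep t A ++_) (profile-descend x t 0 w) ⟩
  rep t A ++ rep t B ++ profile 0 x w
    ≡⟨ cong (λ v → rep t A ++ rep t B ++ v) (profile-0 x w) ⟩
  rep t A ++ rep t B ++ profile₀ w
    ∎
  where open ≡-Reasoning

profile-collectableWith : ∀ {X μ} → CollectableWith X μ → profile₀ X ≡ blocks μ
profile-collectableWith done = refl
profile-collectableWith (blkAB t {w} c) = trans (profile-block A (suc t) w)
  (cong (λ v → rep (suc t) A ++ rep (suc t) B ++ v) (profile-collectableWith c))
profile-collectableWith (blkBA t {w} c) = trans (profile-block B (suc t) w)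
  (cong (λ v → rep (suc t) A ++ rep (suc t) B ++ v) (profile-collectableWith c))

unclimb : ∀ x n d w Z → profile (suc d) x w ≡ rep n A ++ Z →
  ∃ λ w' → w ≡ rep n x ++ w' × profile (suc (n + d)) x w' ≡ Z
unclimb x zero d w Z e = w , refl , e
unclimb A (suc n) d (A ∷ w) Z e with unclimb A n (suc d) w Z (∷-injectiveʳ e)
... | w' , refl , e' = w' , refl , subst (λ k → profile (suc k) A w' ≡ Z) (+-suc n d) e'
unclimb B (suc n) d (B ∷ w) Z e with unclimb B n (suc d) w Z (∷-injectiveʳ e)
... | w' , refl , e' = w' , refl , subst (λ k → profile (suc k) B w' ≡ Z) (+-suc n d) e'

undescend : ∀ x n d w Z → profile (n + d) x w ≡ rep n B ++ Z →
  ∃ λ w' → w ≡ rep n (other x) ++ w' × profile d x w' ≡ Z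
undescend x zero d w Z e = w , refl , e
undescend A (suc n) d (B ∷ w) Z e with undescend A n d w Z (∷-injectiveʳ e)
... | w' , refl , e' = w' , refl , e'
undescend B (suc n) d (A ∷ w) Z e with undescend B n d w Z (∷-injectiveʳ e)
... | w' , refl , e' = w' , refl , e'

unblock : ∀ t X Z → profile₀ X ≡ rep (suc t) A ++ rep (suc t) B ++ Z →
  ∃₂ λ x X' → X ≡ rep (suc t) x ++ rep (suc t) (other x) ++ X' × profile₀ X' ≡ Z
unblock t (y ∷ X) Z e with unclimb y t 0 X _ (∷-injectiveʳ e)
... | X₁ , refl , e₁ with undescend y (suc t) 0 X₁ Z e₁
... | X₂ , refl , e₂ = y , X₂ , refl , trans (sym (profile-0 y X₂)) e₂

blk : ∀ x t {w ts} → CollectableWith w ts →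
  CollectableWith (rep (suc t) x ++ rep (suc t) (other x) ++ w) (suc t ∷ ts)
blk A = blkAB
blk B = blkBA

collectableWith-respects-profile : ∀ {P X μ} →
  CollectableWith P μ → profile₀ X ≡ profile₀ P → CollectableWith X μ
collectableWith-respects-profile {X = []} done e = done
collectableWith-respects-profile (blkAB t {w} c) e with unblock t _ _ (trans e (profile-block A (suc t) w))
... | x , X' , refl , e' = blk x t (collectableWith-respects-profile c e')
collectableWith-respects-profile (blkBA t {w} c) e with unblock t _ _ (trans e (profile-block B (suc t) w))
... | x , X' , refl , e' = blk x t (collectableWith-respects-profile c e')

profile≡blocks⇒collectable : ∀ μ X → profile₀ X ≡ blocks μ → Collectable X
profile≡blocks⇒collectable [] [] e = [] , done
profile≡blocks⇒collectable (zero ∷ μ) X e = profile≡blocks⇒collectable μ X e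
profile≡blocks⇒collectable (suc t ∷ μ) X e with unblock t X _ e
... | x , X' , refl , e' with profile≡blocks⇒collectable μ X' e'
... | ts , c = suc t ∷ ts , blk x t c

erase-past-A : ∀ n a b Z → erase (suc (n + a)) b (rep n A ++ Z) ≡ rep n A ++ erase (suc a) b Z
erase-past-A zero a b Z = refl
erase-past-A (suc n) a b Z = cong (A ∷_) (erase-past-A n a b Z)

erase-past-B : ∀ n a b Z → erase a (suc (n + b)) (rep n B ++ Z) ≡ rep n B ++ erase a (suc b) Z
erase-past-B zero a b Z = refl
erase-past-B (suc n) a b Z = cong (B ∷_) (erase-past-B n a b Z)

erase-0-past-A : ∀ n b Z → erase 0 b (rep n A ++ Z) ≡ rep n A ++ erase 0 b Z
erase-0-past-A zero b Z = refl
erase-0-past-A (suc n) b Z = cong (A ∷_) (erase-0-past-A n b Z)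

erase-within-A : ∀ a m b Z → erase (suc a) b (rep (suc (a + m)) A ++ Z) ≡ rep (a + m) A ++ erase 0 b Z
erase-within-A zero m b Z = erase-0-past-A m b Z
erase-within-A (suc a) m b Z = cong (A ∷_) (erase-within-A a m b Z)

erase-within-B : ∀ b m Z → erase 0 (suc b) (rep (suc (b + m)) B ++ Z) ≡ rep (b + m) B ++ Z
erase-within-B zero m Z = erase-0-0 _
erase-within-B (suc b) m Z = cong (B ∷_) (erase-within-B b m Z)

erase-blocks : ∀ j μ → ∃ λ ν → erase j j (blocks μ) ≡ blocks ν
erase-blocks zero μ = μ , erase-0-0 _
erase-blocks (suc j) [] = [] , refl
erase-blocks (suc j) (t ∷ μ) with <-≤-connex j t
... | inj₁ j<t with m≤n⇒∃[o]m+o≡n j<t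
...   | m , refl = j + m ∷ μ , (begin
  erase (suc j) (suc j) (rep (suc (j + m)) A ++ rep (suc (j + m)) B ++ blocks μ)
    ≡⟨ erase-within-A j m (suc j) _ ⟩
  rep (j + m) A ++ erase 0 (suc j) (rep (suc (j + m)) B ++ blocks μ)
    ≡⟨ cong (rep (j + m) A ++_) (erase-within-B j m (blocks μ)) ⟩
  rep (j + m) A ++ rep (j + m) B ++ blocks μ ∎)
  where open ≡-Reasoning
erase-blocks (suc j) (t ∷ μ) | inj₂ t≤j with m≤n⇒∃[o]m+o≡n t≤j
... | i , refl with erase-blocks (suc i) μ
...   | ν , e = t ∷ ν , (begin
  erase (suc (t + i)) (suc (t + i)) (rep t A ++ rep t B ++ blocks μ)
    ≡⟨ erase-past-A t i _ _ ⟩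
  rep t A ++ erase (suc i) (suc (t + i)) (rep t B ++ blocks μ)
    ≡⟨ cong (rep t A ++_) (erase-past-B t _ i _) ⟩
  rep t A ++ rep t B ++ erase (suc i) (suc i) (blocks μ)
    ≡⟨ cong (λ v → rep t A ++ rep t B ++ v) e ⟩
  rep t A ++ rep t B ++ blocks ν ∎)
  where open ≡-Reasoning

-- a counts the current run of A's, s the B's still to be skipped after its first B
readBlocks : ℕ → ℕ → List Letter → List ℕ
readBlocks a s [] = []
readBlocks a (suc s) (x ∷ w) = readBlocks a s w
readBlocks a zero (A ∷ w) = readBlocks (suc a) zero w
readBlocks a zero (B ∷ w) = a ∷ readBlocks zero (pred a) w

readBlocks-repA : ∀ n a w → readBlocks a 0 (rep n A ++ w) ≡ readBlocks (n + a) 0 w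
readBlocks-repA zero a w = refl
readBlocks-repA (suc n) a w =
  trans (readBlocks-repA n (suc a) w) (cong (λ k → readBlocks k 0 w) (+-suc n a))

readBlocks-repB : ∀ s w → readBlocks 0 s (rep s B ++ w) ≡ readBlocks 0 0 w
readBlocks-repB zero w = refl
readBlocks-repB (suc s) w = readBlocks-repB s w

readBlocks-block : ∀ t w →
  readBlocks 0 0 (rep (suc t) A ++ rep (suc t) B ++ w) ≡ suc t ∷ readBlocks 0 0 w
readBlocks-block t w rewrite readBlocks-repA (suc t) 0 (rep (suc t) B ++ w) | +-identityʳ t =
  cong (suc t ∷_) (readBlocks-repB t w)

readBlocks-profile : ∀ {X μ} → CollectableWith X μ → readBlocks 0 0 (profile₀ X) ≡ μ
readBlocks-profile c = trans (cong (readBlocks 0 0) (profile-collectableWith c)) (readBlocks-blocks c)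
  where
  readBlocks-blocks : ∀ {X μ} → CollectableWith X μ → readBlocks 0 0 (blocks μ) ≡ μ
  readBlocks-blocks done = refl
  readBlocks-blocks (blkAB t {ts = ts} c) =
    trans (readBlocks-block t (blocks ts)) (cong (suc t ∷_) (readBlocks-blocks c))
  readBlocks-blocks (blkBA t {ts = ts} c) =
    trans (readBlocks-block t (blocks ts)) (cong (suc t ∷_) (readBlocks-blocks c))

_≟ᴸ_ : (x y : Letter) → Dec (x ≡ y)
A ≟ᴸ A = yes refl
A ≟ᴸ B = no λ ()
B ≟ᴸ A = no λ ()
B ≟ᴸ B = yes refl

_≟ᵂ_ : (W W' : List Letter) → Dec (W ≡ W')
_≟ᵂ_ = ≡-dec _≟ᴸ_

collectable? : ∀ X → Dec (Collectable X)
collectable? X = map′ (profile≡blocks⇒collectable μ X) canonical (profile₀ X ≟ᵂ blocks μ)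
  where
  μ : List ℕ
  μ = readBlocks 0 0 (profile₀ X)

  canonical : Collectable X → profile₀ X ≡ blocks μ
  canonical (ν , c) = trans (profile-collectableWith c) (cong blocks (sym (readBlocks-profile c)))

head-erase : ∀ a b W → a ≢ 1 → b ≢ 1 → head (erase a b W) ≡ head W
head-erase a b [] _ _ = refl
head-erase zero b (A ∷ W) _ _ = refl
head-erase (suc zero) b (A ∷ W) a≢1 _ = contradiction refl a≢1
head-erase (suc (suc a)) b (A ∷ W) _ _ = refl
head-erase a zero (B ∷ W) _ _ = refl
head-erase a (suc zero) (B ∷ W) _ b≢1 = contradiction refl b≢1
head-erase a (suc (suc b)) (B ∷ W) _ _ = refl

erase-A∷-cancel : ∀ a b W W' →
  erase a b (A ∷ W) ≡ erase a b (A ∷ W') → erase (pred a) b W ≡ erase (pred a) b W'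
erase-A∷-cancel zero b W W' e = ∷-injectiveʳ e
erase-A∷-cancel (suc zero) b W W' e = e
erase-A∷-cancel (suc (suc a)) b W W' e = ∷-injectiveʳ e

erase-B∷-cancel : ∀ a b W W' →
  erase a b (B ∷ W) ≡ erase a b (B ∷ W') → erase a (pred b) W ≡ erase a (pred b) W'
erase-B∷-cancel a zero W W' e = ∷-injectiveʳ e
erase-B∷-cancel a (suc zero) W W' e = e
erase-B∷-cancel a (suc (suc b)) W W' e = ∷-injectiveʳ e

∸≢1 : ∀ l p → l ≢ suc p → l ∸ p ≢ 1
∸≢1 (suc l) zero l≢1+p refl = l≢1+p refl
∸≢1 (suc l) (suc p) l≢1+p = ∸≢1 l p (l≢1+p ∘ cong suc)

avoid-two : ∀ p q → ∃ λ l → 1 ≤ l × l ≤ 3 × l ≢ suc p × l ≢ suc q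
avoid-two zero zero = 2 , s≤s z≤n , s≤s (s≤s z≤n) , (λ ()) , (λ ())
avoid-two zero (suc zero) = 3 , s≤s z≤n , ≤-refl , (λ ()) , (λ ())
avoid-two zero (suc (suc q)) = 2 , s≤s z≤n , s≤s (s≤s z≤n) , (λ ()) , (λ ())
avoid-two (suc zero) zero = 3 , s≤s z≤n , ≤-refl , (λ ()) , (λ ())
avoid-two (suc zero) (suc q) = 1 , ≤-refl , s≤s z≤n , (λ ()) , (λ ())
avoid-two (suc (suc p)) zero = 2 , s≤s z≤n , s≤s (s≤s z≤n) , (λ ()) , (λ ())
avoid-two (suc (suc p)) (suc q) = 1 , ≤-refl , s≤s z≤n , (λ ()) , (λ ())

-- The erasures agree after p A's and q B's have been read; an occurrence already
-- read gets index 0 by truncated subtraction, i.e. is not erased.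
Agree : ℕ → ℕ → List Letter → List Letter → Set
Agree p q W W' =
  ∀ l → 1 ≤ l → l ≤ 3 → erase (l ∸ p) (l ∸ q) W ≡ erase (l ∸ p) (l ∸ q) W'

agree-head : ∀ p q W W' → Agree p q W W' → head W ≡ head W'
agree-head p q W W' agree =
  let l , 1≤l , l≤3 , l≢1+p , l≢1+q = avoid-two p q
      keeps = λ V → head-erase (l ∸ p) (l ∸ q) V (∸≢1 l p l≢1+p) (∸≢1 l q l≢1+q)
  in trans (sym (keeps W)) (trans (cong head (agree l 1≤l l≤3)) (keeps W'))

agree-tailA : ∀ p q W W' → Agree p q (A ∷ W) (A ∷ W') → Agree (suc p) q W W'
agree-tailA p q W W' agree l 1≤l l≤3 =
  subst (λ a → erase a (l ∸ q) W ≡ erase a (l ∸ q) W') (pred[m∸n]≡m∸[1+n] l p)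
        (erase-A∷-cancel (l ∸ p) (l ∸ q) W W' (agree l 1≤l l≤3))

agree-tailB : ∀ p q W W' → Agree p q (B ∷ W) (B ∷ W') → Agree p (suc q) W W'
agree-tailB p q W W' agree l 1≤l l≤3 =
  subst (λ b → erase (l ∸ p) b W ≡ erase (l ∸ p) b W') (pred[m∸n]≡m∸[1+n] l q)
        (erase-B∷-cancel (l ∸ p) (l ∸ q) W W' (agree l 1≤l l≤3))

agree⇒≡ : ∀ p q W W' → Agree p q W W' → W ≡ W'
agree⇒≡ p q [] [] _ = refl
agree⇒≡ p q (A ∷ W) (A ∷ W') agree =
  cong (A ∷_) (agree⇒≡ (suc p) q W W' (agree-tailA p q W W' agree))
agree⇒≡ p q (B ∷ W) (B ∷ W') agree =
  cong (B ∷_) (agree⇒≡ p (suc q) W W' (agree-tailB p q W W' agree))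
agree⇒≡ p q [] W'@(_ ∷ _) agree = case agree-head p q [] W' agree of λ ()
agree⇒≡ p q W@(_ ∷ _) [] agree = case agree-head p q W [] agree of λ ()
agree⇒≡ p q W@(A ∷ _) W'@(B ∷ _) agree = case agree-head p q W W' agree of λ ()
agree⇒≡ p q W@(B ∷ _) W'@(A ∷ _) agree = case agree-head p q W W' agree of λ ()

erase-separates : ∀ W W' → W ≢ W' → ∃ λ j → 1 ≤ j × j ≤ 3 × erase j j W ≢ erase j j W'
erase-separates W W' W≢W'
  with erase 1 1 W ≟ᵂ erase 1 1 W' | erase 2 2 W ≟ᵂ erase 2 2 W' | erase 3 3 W ≟ᵂ erase 3 3 W'
... | no ne | _ | _ = 1 , ≤-refl , s≤s z≤n , ne
... | yes _ | no ne | _ = 2 , s≤s z≤n , s≤s (s≤s z≤n) , ne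
... | yes _ | yes _ | no ne = 3 , s≤s z≤n , ≤-refl , ne
... | yes e₁ | yes e₂ | yes e₃ = contradiction (agree⇒≡ 0 0 W W' agree) W≢W'
  where
  agree : Agree 0 0 W W'
  agree 1 _ _ = e₁
  agree 2 _ _ = e₂
  agree 3 _ _ = e₃
  agree (suc (suc (suc (suc _)))) _ (s≤s (s≤s (s≤s ())))

profile-minus : ∀ j X → profile₀ (minus X j) ≡ erase j j (profile₀ X)
profile-minus j X = trans (cong profile₀ (delOcc-delOcc≡erase j j X)) (profile-erase j X)

collectable-minus : ∀ j {X} → Collectable X → Collectable (minus X j)
collectable-minus j {X} (μ , c) = let ν , e = erase-blocks j μ in
  profile≡blocks⇒collectable ν (minus X j) (begin
    profile₀ (minus X j)   ≡⟨ profile-minus j X ⟩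
    erase j j (profile₀ X) ≡⟨ cong (erase j j) (profile-collectableWith c) ⟩
    erase j j (blocks μ)   ≡⟨ e ⟩
    blocks ν               ∎)
  where open ≡-Reasoning

harmonious⇒profile≡ : ∀ {X Y} → Harmonious X Y → profile₀ X ≡ profile₀ Y
harmonious⇒profile≡ (μ , cX , cY) = trans (profile-collectableWith cX) (sym (profile-collectableWith cY))

mismatch⇒profile≢ : ∀ {X Y} → Mismatch X Y → profile₀ X ≢ profile₀ Y
mismatch⇒profile≢ (inj₁ ((μ , cX) , ¬cY)) e =
  ¬cY (μ , collectableWith-respects-profile cX (sym e))
mismatch⇒profile≢ (inj₂ (inj₁ (¬cX , (μ , cY)))) e =
  ¬cX (μ , collectableWith-respects-profile cY e)
mismatch⇒profile≢ (inj₂ (inj₂ ((μ , cX) , _ , ¬h))) e =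
  ¬h (μ , cX , collectableWith-respects-profile cX (sym e))

mismatch⇒collectable : ∀ {X Y} → Mismatch X Y → Collectable X ⊎ Collectable Y
mismatch⇒collectable (inj₁ (cX , _)) = inj₁ cX
mismatch⇒collectable (inj₂ (inj₁ (_ , cY))) = inj₂ cY
mismatch⇒collectable (inj₂ (inj₂ (cX , _))) = inj₁ cX

profile≢⇒mismatch : ∀ {X Y} →
  Collectable X ⊎ Collectable Y → profile₀ X ≢ profile₀ Y → Mismatch X Y
profile≢⇒mismatch {X} {Y} (inj₁ cX) X≢Y with collectable? Y
... | yes cY = inj₂ (inj₂ (cX , cY , X≢Y ∘ harmonious⇒profile≡))
... | no ¬cY = inj₁ (cX , ¬cY)
profile≢⇒mismatch {X} {Y} (inj₂ cY) X≢Y with collectable? X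
... | yes cX = inj₂ (inj₂ (cX , cY , X≢Y ∘ harmonious⇒profile≡))
... | no ¬cX = inj₂ (inj₁ (¬cX , cY))

mainTheorem7 : (r : ℕ) → 3 ≤ r → (P Q : List Letter) →
    IsPattern r P → IsPattern r Q → Mismatch P Q →
    ∃ λ j → 1 ≤ j × j ≤ r × Mismatch (minus P j) (minus Q j)
mainTheorem7 r 3≤r P Q _ _ mismatch =
  let j , 1≤j , j≤3 , erased≢ = erase-separates _ _ (mismatch⇒profile≢ mismatch)
      one-collectable = map-⊎ (collectable-minus j) (collectable-minus j) (mismatch⇒collectable mismatch)
      profiles≢ e = erased≢ (trans (sym (profile-minus j P)) (trans e (profile-minus j Q)))
  in j , 1≤j , ≤-trans j≤3 3≤r , profile≢⇒mismatch one-collectable profiles≢
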